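{- Let $(\Gamma,\psi)$ be a divisible $H$-type asymptotic couple. Suppose $(\Gamma\oplus\mathbb{Q}\alpha,\psi^\alpha)$ and $(\Gamma\oplus\mathbb{Q}\beta,\psi^\beta)$ are two $H$-type asymptotic couples extending $(\Gamma,\psi)$ (with underlying ordered groups the direct sums $\Gamma\oplus\mathbb{Q}\alpha$ and $\Gamma\oplus\mathbb{Q}\beta$) such that (1) $[\Gamma\oplus\mathbb{Q}\alpha]=[\Gamma]$, i.e. every element of $\Gamma\oplus\mathbb{Q}\alpha$ lies in the archimedean class of some element of $\Gamma$; and (2) $\alpha$ and $\beta$ realize the same cut over $\Gamma$. Then the isomorphism $i:\Gamma\oplus\mathbb{Q}\alpha\to\Gamma\oplus\mathbb{Q}\beta$ of ordered abelian groups over $\Gamma$ sending $\alpha$ to $\beta$ is also an isomorphism $(\Gamma\oplus\mathbb{Q}\alpha,\psi^\alpha)\to(\Gamma\oplus\mathbb{Q}\beta,\psi^\beta)$ of asymptotic couples over $(\Gamma,\psi)$.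
   Context: An asymptotic couple is $(\Gamma,\psi)$, $\Gamma$ an ordered abelian group, $\psi:\Gamma\setminus\{0\}\to\Gamma$ with (AC1) $\alpha+\beta\ne0\Rightarrow\psi(\alpha+\beta)\ge\min(\psi\alpha,\psi\beta)$, (AC2) $\psi(r\alpha)=\psi\alpha$ for $r\in\mathbb{Z}\setminus\{0\}$, (AC3) $\alpha>0\Rightarrow\alpha+\psi\alpha>\psi\beta$; $H$-type means $0<\alpha\le\beta\Rightarrow\psi\alpha\ge\psi\beta$. An extension is a superstructure on which the new $\psi$ restricts to the old one. For $a$ in an ordered abelian group $G$, the archimedean class is $[a]=\{g:|a|\le n|g|\text{ and }|g|\le n|a|\text{ for some }n\ge1\}$, and $[X]=\{[x]:x\in X\}$. Two elements realize the same cut over $\Gamma$ if they have the same set of elements of $\Gamma$ below them. -}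

module Defs where

open import Level using (0ℓ)
open import Data.Nat as ℕ using (ℕ; zero; suc)
open import Data.Integer as ℤ using (ℤ; +_; -[1+_])
open import Data.Rational as ℚ using (ℚ)
open import Data.Product using (Σ; ∃; _×_; _,_; proj₁; proj₂)
open import Data.Sum using (_⊎_)
open import Relation.Binary.Core using (Rel)
open import Relation.Binary.Definitions using (Trichotomous; Tri; tri<; tri≈; tri>)
open import Relation.Binary.PropositionalEquality using (_≡_; _≢_)
open import Relation.Nullary using (¬_)

record IsOrderedAbGroup {A : Set} (0# : A) (_+_ : A → A → A) (-_ : A → A)
                        (_<_ : Rel A 0ℓ) : Set where
  field
    +-assoc     : ∀ a b c → (a + b) + c ≡ a + (b + c)
    +-comm      : ∀ a b → a + b ≡ b + a
    +-identityˡ : ∀ a → 0# + a ≡ a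
    -‿inverseˡ  : ∀ a → (- a) + a ≡ 0#
    <-irrefl    : ∀ a → ¬ (a < a)
    <-trans     : ∀ {a b c} → a < b → b < c → a < c
    <-tri       : Trichotomous _≡_ _<_
    <-compat    : ∀ {a b} c → a < b → (a + c) < (b + c)

record OrderedAbGroup : Set₁ where
  infixl 6 _+_
  infix 4 _<_ _≤_
  field
    Carrier : Set
    0#      : Carrier
    _+_     : Carrier → Carrier → Carrier
    -_      : Carrier → Carrier
    _<_     : Rel Carrier 0ℓ
    isOrderedAbGroup : IsOrderedAbGroup 0# _+_ -_ _<_
  open IsOrderedAbGroup isOrderedAbGroup public

  _≤_ : Rel Carrier 0ℓ
  a ≤ b = (a < b) ⊎ (a ≡ b)

  _·ℕ_ : ℕ → Carrier → Carrier
  zero  ·ℕ a = 0#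
  suc n ·ℕ a = a + (n ·ℕ a)

  _·ℤ_ : ℤ → Carrier → Carrier
  (+ n)    ·ℤ a = n ·ℕ a
  -[1+ n ] ·ℤ a = - (suc n ·ℕ a)

  ∣_∣ : Carrier → Carrier
  ∣ a ∣ with <-tri a 0#
  ... | tri< _ _ _ = - a
  ... | tri≈ _ _ _ = a
  ... | tri> _ _ _ = a

  InArchClass : Carrier → Carrier → Set
  InArchClass a b = ∃ λ n → (1 ℕ.≤ n) × (∣ a ∣ ≤ n ·ℕ ∣ b ∣) × (∣ b ∣ ≤ n ·ℕ ∣ a ∣)

  Divisible : Set
  Divisible = ∀ (n : ℕ) → 1 ℕ.≤ n → ∀ a → ∃ λ b → n ·ℕ b ≡ a

-- Asymptotic couples.  ψ is given as a total map Carrier → Carrier whose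
-- value at 0 is irrelevant: all axioms (and all uses) only concern ψ on
-- Γ ∖ {0}.

module _ (G : OrderedAbGroup) where
  open OrderedAbGroup G

  record IsAsymptoticCouple (ψ : Carrier → Carrier) : Set where
    field
      AC1 : ∀ a b → a ≢ 0# → b ≢ 0# → a + b ≢ 0# →
            (ψ a ≤ ψ (a + b)) ⊎ (ψ b ≤ ψ (a + b))
      AC2 : ∀ (r : ℤ) a → r ≢ ℤ.0ℤ → a ≢ 0# → ψ (r ·ℤ a) ≡ ψ a
      AC3 : ∀ a b → 0# < a → b ≢ 0# → ψ b < a + ψ a

  record IsHAsymptoticCouple (ψ : Carrier → Carrier) : Set where
    field
      isAsymptoticCouple : IsAsymptoticCouple ψ
      H-type : ∀ a b → 0# < a → a ≤ b → ψ b ≤ ψ a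

-- The direct sum Γ ⊕ ℚα, with carrier Γ × ℚ: (γ , q) stands for γ + qα.

module DirectSum (Γ : OrderedAbGroup) where
  open OrderedAbGroup Γ renaming (Carrier to G; 0# to 0G; _+_ to _+G_; -_ to -G_; _<_ to _<G_)

  ⊕Carrier : Set
  ⊕Carrier = G × ℚ

  ⊕0 : ⊕Carrier
  ⊕0 = 0G , ℚ.0ℚ

  _⊕+_ : ⊕Carrier → ⊕Carrier → ⊕Carrier
  (g , p) ⊕+ (h , q) = (g +G h) , (p ℚ.+ q)

  ⊕- : ⊕Carrier → ⊕Carrier
  ⊕- (g , p) = (-G g) , (ℚ.- p)

  ι : G → ⊕Carrier
  ι g = g , ℚ.0ℚ

  gen : ⊕Carrier
  gen = 0G , ℚ.1ℚ

  record HExtension (ψ : G → G) : Set₁ where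
    field
      _<ₑ_ : Rel ⊕Carrier 0ℓ
      isOAG : IsOrderedAbGroup ⊕0 _⊕+_ ⊕- _<ₑ_
      ψₑ : ⊕Carrier → ⊕Carrier

    group : OrderedAbGroup
    group = record { Carrier = ⊕Carrier ; 0# = ⊕0 ; _+_ = _⊕+_ ; -_ = ⊕-
                   ; _<_ = _<ₑ_ ; isOrderedAbGroup = isOAG }

    field
      isHAC : IsHAsymptoticCouple group ψₑ
      extends-< : ∀ g h → (ι g <ₑ ι h → g <G h) × (g <G h → ι g <ₑ ι h)
      extends-ψ : ∀ g → g ≢ 0G → ψₑ (ι g) ≡ ι (ψ g)

module Submission where

-- Write x = g + (n/d)α with n > 0.  Then d·x = n·(h + α) where n·h = d·g (Γ is divisible), so
-- x > 0 iff -h < α: the sign of x is read off the cut of α over Γ, which is the same for β.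
-- Negative n reduces to this via -x, and n = 0 is the order of Γ; hence both extensions carry
-- the same order.  An H-type ψ is constant on archimedean classes, and every x ≠ 0 is
-- archimedean-equivalent to some g ∈ Γ, so both ψ's take the value ψ g at x.

open import Data.Empty using (⊥-elim)
open import Data.Integer as ℤ using (+_; -[1+_])
open import Data.Integer.Tactic.RingSolver using (solve-∀)
open import Data.Nat as ℕ using (zero; suc)
open import Data.Product using (∃; _×_; _,_; proj₁; proj₂)
open import Data.Rational as ℚ using (ℚ; mkℚ; toℚᵘ; ↥_; ↧ₙ_)
import Data.Rational.Properties as ℚ
open import Data.Rational.Unnormalised as ℚᵘ using (mkℚᵘ; *≡*) renaming (_≃_ to _≃ᵘ_)
import Data.Rational.Unnormalised.Properties as ℚᵘ
open import Algebra.Definitions.RawMonoid ℚ.+-0-rawMonoid using () renaming (_×_ to _×ℚ_)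
open import Data.Sum using (_⊎_; inj₁; inj₂)
open import Defs
open import Function using (_∘_)
open import Level using (0ℓ)
open import Relation.Binary.Core using (Rel)
open import Relation.Binary.Definitions using (Tri; tri<; tri≈; tri>)
open import Relation.Binary.PropositionalEquality
open import Relation.Nullary using (¬_)

toℚᵘ-×ℚ : ∀ n q → toℚᵘ (n ×ℚ q) ≃ᵘ mkℚᵘ (+ n ℤ.* ↥ q) (ℚ.denominator-1 q)
toℚᵘ-×ℚ zero    (mkℚ a d _) = *≡* (lemma a (+ suc d))
  where
  lemma : ∀ a D → + 0 ℤ.* D ≡ (+ 0 ℤ.* a) ℤ.* + 1
  lemma = solve-∀
toℚᵘ-×ℚ (suc n) q@(mkℚ a d _) = begin
  toℚᵘ (q ℚ.+ n ×ℚ q)                ≈⟨ ℚ.toℚᵘ-homo-+ q (n ×ℚ q) ⟩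
  mkℚᵘ a d ℚᵘ.+ toℚᵘ (n ×ℚ q)         ≈⟨ ℚᵘ.+-congʳ (mkℚᵘ a d) (toℚᵘ-×ℚ n q) ⟩
  mkℚᵘ a d ℚᵘ.+ mkℚᵘ (+ n ℤ.* a) d   ≈⟨ *≡* (lemma (+ n) a (+ suc d)) ⟩
  mkℚᵘ (+ suc n ℤ.* a) d             ∎
  where
  open ℚᵘ.≃-Reasoning
  lemma : ∀ n a D → (a ℤ.* D ℤ.+ (n ℤ.* a) ℤ.* D) ℤ.* D ≡ ((+ 1 ℤ.+ n) ℤ.* a) ℤ.* (D ℤ.* D)
  lemma = solve-∀

denominator-×ℚ-cancel : ∀ q a → ↥ q ≡ + a → ↧ₙ q ×ℚ q ≡ a ×ℚ ℚ.1ℚ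
denominator-×ℚ-cancel q@(mkℚ _ d _) a refl = ℚ.toℚᵘ-injective (begin
  toℚᵘ (suc d ×ℚ q)          ≈⟨ toℚᵘ-×ℚ (suc d) q ⟩
  mkℚᵘ (+ suc d ℤ.* + a) d   ≈⟨ *≡* (lemma (+ suc d) (+ a)) ⟩
  mkℚᵘ (+ a ℤ.* + 1) 0       ≈⟨ toℚᵘ-×ℚ a ℚ.1ℚ ⟨
  toℚᵘ (a ×ℚ ℚ.1ℚ)           ∎)
  where
  open ℚᵘ.≃-Reasoning
  lemma : ∀ D a → (D ℤ.* a) ℤ.* + 1 ≡ (a ℤ.* + 1) ℤ.* D
  lemma = solve-∀

module OrderedAbGroupProperties (G : OrderedAbGroup) where
  open OrderedAbGroup G

  +-identityʳ : ∀ a → a + 0# ≡ a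
  +-identityʳ a = trans (+-comm a 0#) (+-identityˡ a)

  -‿inverseʳ : ∀ a → a + - a ≡ 0#
  -‿inverseʳ a = trans (+-comm a (- a)) (-‿inverseˡ a)

  neg⇒-pos : ∀ {a} → a < 0# → 0# < - a
  neg⇒-pos {a} a<0 = subst₂ _<_ (-‿inverseʳ a) (+-identityˡ (- a)) (<-compat (- a) a<0)

  pos+pos : ∀ {a b} → 0# < a → 0# < b → 0# < a + b
  pos+pos {a} {b} 0<a 0<b =
    <-trans 0<a (subst₂ _<_ (+-identityˡ a) (+-comm b a) (<-compat a 0<b))

  neg+neg : ∀ {a b} → a < 0# → b < 0# → a + b < 0#
  neg+neg {a} {b} a<0 b<0 =
    <-trans (subst₂ _<_ (+-comm b a) (+-identityˡ a) (<-compat a b<0)) a<0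

  pos⇒¬-pos : ∀ {a} → 0# < a → ¬ (0# < - a)
  pos⇒¬-pos {a} 0<a 0<-a = <-irrefl 0# (subst (0# <_) (-‿inverseʳ a) (pos+pos 0<a 0<-a))

  pos⊎zero⊎-pos : ∀ a → 0# < a ⊎ a ≡ 0# ⊎ 0# < - a
  pos⊎zero⊎-pos a with <-tri a 0#
  ... | tri< a<0 _ _ = inj₂ (inj₂ (neg⇒-pos a<0))
  ... | tri≈ _ a≡0 _ = inj₂ (inj₁ a≡0)
  ... | tri> _ _ 0<a = inj₁ 0<a

  <⇒pos-diff : ∀ {a b} → a < b → 0# < b + - a
  <⇒pos-diff {a} {b} a<b = subst (_< b + - a) (-‿inverseʳ a) (<-compat (- a) a<b)

  pos-diff⇒< : ∀ {a b} → 0# < b + - a → a < b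
  pos-diff⇒< {a} {b} 0<b-a = subst₂ _<_ (+-identityˡ a) b-a+a≡b (<-compat a 0<b-a)
    where
    b-a+a≡b : (b + - a) + a ≡ b
    b-a+a≡b = trans (+-assoc b (- a) a) (trans (cong (λ x → b + x) (-‿inverseˡ a)) (+-identityʳ b))

  ≤-antisym : ∀ {a b} → a ≤ b → b ≤ a → a ≡ b
  ≤-antisym (inj₂ a≡b) _          = a≡b
  ≤-antisym (inj₁ _)   (inj₂ b≡a) = sym b≡a
  ≤-antisym (inj₁ a<b) (inj₁ b<a) = ⊥-elim (<-irrefl _ (<-trans a<b b<a))

  ·ℕ-zeroʳ : ∀ n → n ·ℕ 0# ≡ 0#
  ·ℕ-zeroʳ zero    = refl
  ·ℕ-zeroʳ (suc n) = trans (+-identityˡ _) (·ℕ-zeroʳ n)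

  ·ℕ-pos : ∀ {a} k → 0# < a → 0# < suc k ·ℕ a
  ·ℕ-pos zero    0<a = subst (0# <_) (sym (+-identityʳ _)) 0<a
  ·ℕ-pos (suc k) 0<a = pos+pos 0<a (·ℕ-pos k 0<a)

  ·ℕ-neg : ∀ {a} k → a < 0# → suc k ·ℕ a < 0#
  ·ℕ-neg zero    a<0 = subst (_< 0#) (sym (+-identityʳ _)) a<0
  ·ℕ-neg (suc k) a<0 = neg+neg a<0 (·ℕ-neg k a<0)

  ·ℕ-pos⁻¹ : ∀ {a} k → 0# < suc k ·ℕ a → 0# < a
  ·ℕ-pos⁻¹ {a} k 0<ka with <-tri 0# a
  ... | tri< 0<a _ _   = 0<a
  ... | tri≈ _ refl _  = ⊥-elim (<-irrefl 0# (subst (0# <_) (·ℕ-zeroʳ (suc k)) 0<ka))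
  ... | tri> _ _ a<0   = ⊥-elim (<-irrefl 0# (<-trans 0<ka (·ℕ-neg k a<0)))

  ∣∣-pos : ∀ {a} → 0# < a → ∣ a ∣ ≡ a
  ∣∣-pos {a} 0<a with <-tri a 0#
  ... | tri< a<0 _ _ = ⊥-elim (<-irrefl a (<-trans a<0 0<a))
  ... | tri≈ _ _ _   = refl
  ... | tri> _ _ _   = refl

  ∣∣-neg : ∀ {a} → a < 0# → ∣ a ∣ ≡ - a
  ∣∣-neg {a} a<0 with <-tri a 0#
  ... | tri< _ _ _    = refl
  ... | tri≈ _ refl _ = ⊥-elim (<-irrefl 0# a<0)
  ... | tri> _ _ 0<a  = ⊥-elim (<-irrefl a (<-trans a<0 0<a))

  ∣0∣≡0 : ∣ 0# ∣ ≡ 0#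
  ∣0∣≡0 with <-tri 0# 0#
  ... | tri< 0<0 _ _ = ⊥-elim (<-irrefl 0# 0<0)
  ... | tri≈ _ _ _   = refl
  ... | tri> _ _ _   = refl

  ∣∣-nonzero-pos : ∀ {a} → a ≢ 0# → 0# < ∣ a ∣
  ∣∣-nonzero-pos {a} a≢0 with <-tri a 0#
  ... | tri< a<0 _ _ = neg⇒-pos a<0
  ... | tri≈ _ a≡0 _ = ⊥-elim (a≢0 a≡0)
  ... | tri> _ _ 0<a = 0<a

  ∣∣-nonzero : ∀ {a} → a ≢ 0# → ∣ a ∣ ≢ 0#
  ∣∣-nonzero a≢0 ∣a∣≡0 = <-irrefl 0# (subst (0# <_) ∣a∣≡0 (∣∣-nonzero-pos a≢0))

  InArchClass-nonzero : ∀ {a b} → InArchClass a b → a ≢ 0# → b ≢ 0#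
  InArchClass-nonzero {a} (n , _ , ∣a∣≤n∣b∣ , _) a≢0 refl
    with subst (∣ a ∣ ≤_) (trans (cong (n ·ℕ_) ∣0∣≡0) (·ℕ-zeroʳ n)) ∣a∣≤n∣b∣
  ... | inj₁ ∣a∣<0 = <-irrefl 0# (<-trans (∣∣-nonzero-pos a≢0) ∣a∣<0)
  ... | inj₂ ∣a∣≡0 = ∣∣-nonzero a≢0 ∣a∣≡0

module HAsymptoticCoupleProperties
  (G : OrderedAbGroup) {ψ : OrderedAbGroup.Carrier G → OrderedAbGroup.Carrier G}
  (H : IsHAsymptoticCouple G ψ) where
  open OrderedAbGroup G
  open OrderedAbGroupProperties G
  open IsHAsymptoticCouple H
  open IsAsymptoticCouple isAsymptoticCouple

  ψ-neg : ∀ {a} → a ≢ 0# → ψ (- a) ≡ ψ a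
  ψ-neg {a} a≢0 = trans (cong (ψ ∘ -_) (sym (+-identityʳ a))) (AC2 -[1+ 0 ] a (λ ()) a≢0)

  ψ-∣∣ : ∀ {a} → a ≢ 0# → ψ ∣ a ∣ ≡ ψ a
  ψ-∣∣ {a} a≢0 with <-tri a 0#
  ... | tri< _ _ _ = ψ-neg a≢0
  ... | tri≈ _ _ _ = refl
  ... | tri> _ _ _ = refl

  ψ-·ℕ : ∀ k {a} → a ≢ 0# → ψ (suc k ·ℕ a) ≡ ψ a
  ψ-·ℕ k {a} = AC2 (+ suc k) a (λ ())

  ψ-antitone-∣∣ : ∀ {a b} n → 1 ℕ.≤ n → a ≢ 0# → b ≢ 0# → ∣ a ∣ ≤ n ·ℕ ∣ b ∣ → ψ b ≤ ψ a
  ψ-antitone-∣∣ {a} {b} (suc k) _ a≢0 b≢0 ∣a∣≤n∣b∣ =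
    subst₂ _≤_ (trans (ψ-·ℕ k (∣∣-nonzero b≢0)) (ψ-∣∣ b≢0)) (ψ-∣∣ a≢0)
      (H-type ∣ a ∣ (suc k ·ℕ ∣ b ∣) (∣∣-nonzero-pos a≢0) ∣a∣≤n∣b∣)

  ψ-InArchClass : ∀ {a b} → a ≢ 0# → InArchClass a b → ψ a ≡ ψ b
  ψ-InArchClass a≢0 a~b@(n , 1≤n , ∣a∣≤n∣b∣ , ∣b∣≤n∣a∣) =
    ≤-antisym (ψ-antitone-∣∣ n 1≤n b≢0 a≢0 ∣b∣≤n∣a∣) (ψ-antitone-∣∣ n 1≤n a≢0 b≢0 ∣a∣≤n∣b∣)
    where b≢0 = InArchClass-nonzero a~b a≢0

module Reordering
  {A : Set} {0# : A} {_+_ : A → A → A} { -_ : A → A} {_<₁_ _<₂_ : Rel A 0ℓ}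
  (O₁ : IsOrderedAbGroup 0# _+_ -_ _<₁_) (O₂ : IsOrderedAbGroup 0# _+_ -_ _<₂_) where

  G₁ G₂ : OrderedAbGroup
  G₁ = record { Carrier = A ; 0# = 0# ; _+_ = _+_ ; -_ = -_ ; _<_ = _<₁_ ; isOrderedAbGroup = O₁ }
  G₂ = record { Carrier = A ; 0# = 0# ; _+_ = _+_ ; -_ = -_ ; _<_ = _<₂_ ; isOrderedAbGroup = O₂ }

  private
    module G₁ = OrderedAbGroup G₁
    module G₂ = OrderedAbGroup G₂
    module P₁ = OrderedAbGroupProperties G₁
    module P₂ = OrderedAbGroupProperties G₂

  SameOrder : Set
  SameOrder = ∀ x y → (x <₁ y → x <₂ y) × (x <₂ y → x <₁ y)

  -- Both orders are total, so a larger positive cone would contain some a together with - a.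
  positive-cone-⊆⇒SameOrder : (∀ x → 0# <₁ x → 0# <₂ x) → SameOrder
  positive-cone-⊆⇒SameOrder pos₁⇒pos₂ x y =
      (λ x<₁y → P₂.pos-diff⇒< (pos₁⇒pos₂ _ (P₁.<⇒pos-diff x<₁y)))
    , (λ x<₂y → P₁.pos-diff⇒< (pos₂⇒pos₁ (P₂.<⇒pos-diff x<₂y)))
    where
    pos₂⇒pos₁ : ∀ {a} → 0# <₂ a → 0# <₁ a
    pos₂⇒pos₁ {a} 0<₂a with P₁.pos⊎zero⊎-pos a
    ... | inj₁ 0<₁a          = 0<₁a
    ... | inj₂ (inj₁ refl)   = ⊥-elim (G₂.<-irrefl 0# 0<₂a)
    ... | inj₂ (inj₂ 0<₁-a)  = ⊥-elim (P₂.pos⇒¬-pos 0<₂a (pos₁⇒pos₂ _ 0<₁-a))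

  module _ (same : SameOrder) where

    ≤₁⇒≤₂ : ∀ {a b} → a G₁.≤ b → a G₂.≤ b
    ≤₁⇒≤₂ (inj₁ a<b) = inj₁ (proj₁ (same _ _) a<b)
    ≤₁⇒≤₂ (inj₂ a≡b) = inj₂ a≡b

    ∣∣-same : ∀ a → G₁.∣ a ∣ ≡ G₂.∣ a ∣
    ∣∣-same a = by-cases (G₁.<-tri a 0#)
      where
      by-cases : Tri (a <₁ 0#) (a ≡ 0#) (0# <₁ a) → G₁.∣ a ∣ ≡ G₂.∣ a ∣
      by-cases (tri< a<0 _ _)  = trans (P₁.∣∣-neg a<0) (sym (P₂.∣∣-neg (proj₁ (same _ _) a<0)))
      by-cases (tri≈ _ refl _) = trans P₁.∣0∣≡0 (sym P₂.∣0∣≡0)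
      by-cases (tri> _ _ 0<a)  = trans (P₁.∣∣-pos 0<a) (sym (P₂.∣∣-pos (proj₁ (same _ _) 0<a)))

    ·ℕ-same : ∀ n a → n G₁.·ℕ a ≡ n G₂.·ℕ a
    ·ℕ-same zero    a = refl
    ·ℕ-same (suc n) a = cong (λ x → a + x) (·ℕ-same n a)

    InArchClass₁⇒₂ : ∀ {a b} → G₁.InArchClass a b → G₂.InArchClass a b
    InArchClass₁⇒₂ {a} {b} (n , 1≤n , ∣a∣≤n∣b∣ , ∣b∣≤n∣a∣) =
      n , 1≤n , bound ∣a∣≤n∣b∣ , bound ∣b∣≤n∣a∣
      where
      bound : ∀ {c d} → G₁.∣ c ∣ G₁.≤ n G₁.·ℕ G₁.∣ d ∣ → G₂.∣ c ∣ G₂.≤ n G₂.·ℕ G₂.∣ d ∣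
      bound {c} {d} = subst₂ G₂._≤_ (∣∣-same c) (trans (cong (n G₁.·ℕ_) (∣∣-same d)) (·ℕ-same n _))
                      ∘ ≤₁⇒≤₂

module HExtensionProperties
  (Γ : OrderedAbGroup) {ψ : OrderedAbGroup.Carrier Γ → OrderedAbGroup.Carrier Γ} where
  open OrderedAbGroup Γ using (Divisible; +-identityˡ; -‿inverseˡ)
    renaming (0# to 0G; -_ to -G_; _·ℕ_ to _·G_)
  open OrderedAbGroupProperties Γ using (-‿inverseʳ)
  open DirectSum Γ
  open HExtension

  module _ (E : HExtension ψ) where
    open OrderedAbGroup (group E) using (<-compat) renaming (_<_ to _<E_; _·ℕ_ to _·E_)
    open OrderedAbGroupProperties (group E) using (·ℕ-pos; ·ℕ-pos⁻¹)

    ·ℕ-⊕ : ∀ n g q → n ·E (g , q) ≡ (n ·G g , n ×ℚ q)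
    ·ℕ-⊕ zero    g q = refl
    ·ℕ-⊕ (suc n) g q = cong ((g , q) ⊕+_) (·ℕ-⊕ n g q)

    pos⇔below-gen : ∀ h → (⊕0 <E (h , ℚ.1ℚ) → ι (-G h) <E gen) × (ι (-G h) <E gen → ⊕0 <E (h , ℚ.1ℚ))
    pos⇔below-gen h =
        subst₂ _<E_ (cong (_, ℚ.0ℚ) (+-identityˡ (-G h))) (cong (_, ℚ.1ℚ) (-‿inverseʳ h))
        ∘ <-compat (ι (-G h))
      , subst₂ _<E_ (cong (_, ℚ.0ℚ) (-‿inverseˡ h)) (cong (_, ℚ.1ℚ) (+-identityˡ h))
        ∘ <-compat (ι h)

    pos⇔below-gen-scaled : ∀ g q k h → ↥ q ≡ + suc k → suc k ·G h ≡ (↧ₙ q) ·G g →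
                           (⊕0 <E (g , q) → ι (-G h) <E gen) × (ι (-G h) <E gen → ⊕0 <E (g , q))
    pos⇔below-gen-scaled g q k h ↥q≡n nh≡dg =
        (λ 0<x → proj₁ (pos⇔below-gen h)
                   (·ℕ-pos⁻¹ k (subst (⊕0 <E_) d·x≡n·y (·ℕ-pos (ℚ.denominator-1 q) 0<x))))
      , (λ below → ·ℕ-pos⁻¹ (ℚ.denominator-1 q)
                   (subst (⊕0 <E_) (sym d·x≡n·y) (·ℕ-pos k (proj₂ (pos⇔below-gen h) below))))
      where
      d·x≡n·y : (↧ₙ q) ·E (g , q) ≡ suc k ·E (h , ℚ.1ℚ)
      d·x≡n·y = begin
        (↧ₙ q) ·E (g , q)              ≡⟨ ·ℕ-⊕ (↧ₙ q) g q ⟩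
        ((↧ₙ q) ·G g , ↧ₙ q ×ℚ q)      ≡⟨ cong₂ _,_ (sym nh≡dg) (denominator-×ℚ-cancel q (suc k) ↥q≡n) ⟩
        (suc k ·G h , suc k ×ℚ ℚ.1ℚ)   ≡⟨ ·ℕ-⊕ (suc k) h ℚ.1ℚ ⟨
        suc k ·E (h , ℚ.1ℚ)            ∎
        where open ≡-Reasoning

  module _ (div : Divisible) where

    positive-numerator-transfer : ∀ (E₁ E₂ : HExtension ψ) →
      (∀ g → _<ₑ_ E₁ (ι g) gen → _<ₑ_ E₂ (ι g) gen) →
      ∀ g q k → ↥ q ≡ + suc k → _<ₑ_ E₁ ⊕0 (g , q) → _<ₑ_ E₂ ⊕0 (g , q)
    positive-numerator-transfer E₁ E₂ cut g q k ↥q≡n 0<₁x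
      with div (suc k) (ℕ.s≤s ℕ.z≤n) ((↧ₙ q) ·G g)
    ... | h , nh≡dg = proj₂ (pos⇔below-gen-scaled E₂ g q k h ↥q≡n nh≡dg)
                        (cut (-G h) (proj₁ (pos⇔below-gen-scaled E₁ g q k h ↥q≡n nh≡dg) 0<₁x))

    module _ (E₁ E₂ : HExtension ψ) where
      private
        module P₁ = OrderedAbGroupProperties (group E₁)
        module P₂ = OrderedAbGroupProperties (group E₂)

      positive-transfer : (∀ g → _<ₑ_ E₁ (ι g) gen → _<ₑ_ E₂ (ι g) gen) →
                          (∀ g → _<ₑ_ E₂ (ι g) gen → _<ₑ_ E₁ (ι g) gen) →
                          ∀ x → _<ₑ_ E₁ ⊕0 x → _<ₑ_ E₂ ⊕0 x
      positive-transfer cut₁₂ cut₂₁ (g , q) 0<₁x with ↥ q in ↥q≡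
      ... | + zero with ℚ.↥p≡0⇒p≡0 q ↥q≡
      ...   | refl = proj₂ (extends-< E₂ 0G g) (proj₁ (extends-< E₁ 0G g) 0<₁x)
      positive-transfer cut₁₂ cut₂₁ (g , q) 0<₁x | + suc k =
        positive-numerator-transfer E₁ E₂ cut₁₂ g q k ↥q≡ 0<₁x
      positive-transfer cut₁₂ cut₂₁ (g , q) 0<₁x | -[1+ k ] with P₂.pos⊎zero⊎-pos (g , q)
      ... | inj₁ 0<₂x         = 0<₂x
      ... | inj₂ (inj₁ refl)  = ⊥-elim (OrderedAbGroup.<-irrefl (group E₁) ⊕0 0<₁x)
      ... | inj₂ (inj₂ 0<₂-x) = ⊥-elim (P₁.pos⇒¬-pos 0<₁x 0<₁-x)
        where
        0<₁-x : _<ₑ_ E₁ ⊕0 (⊕- (g , q))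
        0<₁-x = positive-numerator-transfer E₂ E₁ cut₂₁ (-G g) (ℚ.- q) k
                  (trans (ℚ.↥-neg q) (cong ℤ.-_ ↥q≡)) 0<₂-x

  ψₑ-same : ∀ (E₁ E₂ : HExtension ψ) → Reordering.SameOrder (isOAG E₁) (isOAG E₂) →
    (∀ x → ∃ λ g → OrderedAbGroup.InArchClass (group E₁) x (ι g)) →
    ∀ x → x ≢ ⊕0 → ψₑ E₂ x ≡ ψₑ E₁ x
  ψₑ-same E₁ E₂ same arch x x≢0 with arch x
  ... | g , x~g = begin
    ψₑ E₂ x       ≡⟨ H₂.ψ-InArchClass x≢0 (Reordering.InArchClass₁⇒₂ (isOAG E₁) (isOAG E₂) same x~g) ⟩
    ψₑ E₂ (ι g)   ≡⟨ extends-ψ E₂ g g≢0 ⟩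
    ι (ψ g)       ≡⟨ extends-ψ E₁ g g≢0 ⟨
    ψₑ E₁ (ι g)   ≡⟨ H₁.ψ-InArchClass x≢0 x~g ⟨
    ψₑ E₁ x       ∎
    where
    open ≡-Reasoning
    module H₁ = HAsymptoticCoupleProperties (group E₁) (isHAC E₁)
    module H₂ = HAsymptoticCoupleProperties (group E₂) (isHAC E₂)
    g≢0 : g ≢ 0G
    g≢0 = OrderedAbGroupProperties.InArchClass-nonzero (group E₁) x~g x≢0 ∘ cong ι

corollary5p4 : (Γ : OrderedAbGroup) (ψ : OrderedAbGroup.Carrier Γ → OrderedAbGroup.Carrier Γ) →
    IsHAsymptoticCouple Γ ψ → OrderedAbGroup.Divisible Γ →
    (Eα Eβ : DirectSum.HExtension Γ ψ) →
    (∀ x → ∃ λ g → OrderedAbGroup.InArchClass (DirectSum.HExtension.group Eα) x (DirectSum.ι Γ g)) →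
    (∀ g → (DirectSum.HExtension._<ₑ_ Eα (DirectSum.ι Γ g) (DirectSum.gen Γ) → DirectSum.HExtension._<ₑ_ Eβ (DirectSum.ι Γ g) (DirectSum.gen Γ))
         × (DirectSum.HExtension._<ₑ_ Eβ (DirectSum.ι Γ g) (DirectSum.gen Γ) → DirectSum.HExtension._<ₑ_ Eα (DirectSum.ι Γ g) (DirectSum.gen Γ))) →
    (∀ x y → (DirectSum.HExtension._<ₑ_ Eα x y → DirectSum.HExtension._<ₑ_ Eβ x y)
           × (DirectSum.HExtension._<ₑ_ Eβ x y → DirectSum.HExtension._<ₑ_ Eα x y))
    × (∀ x → x ≢ DirectSum.⊕0 Γ → DirectSum.HExtension.ψₑ Eβ x ≡ DirectSum.HExtension.ψₑ Eα x)
corollary5p4 Γ ψ _ div Eα Eβ arch cut = same , ψₑ-same Eα Eβ same arch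
  where
  open DirectSum.HExtension using (isOAG)
  open HExtensionProperties Γ
  same : Reordering.SameOrder (isOAG Eα) (isOAG Eβ)
  same = Reordering.positive-cone-⊆⇒SameOrder (isOAG Eα) (isOAG Eβ)
           (positive-transfer div Eα Eβ (proj₁ ∘ cut) (proj₂ ∘ cut))
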